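{- For positive integers $m_1,\dots,m_k,m_{k+1}$, $$\bar{R}(m_1,\dots,m_k,m_{k+1})\le\bar{R}(m_1,\dots,m_k).$$ Moreover, equality holds if $m_{k+1}\ge\bar{R}(m_1,\dots,m_k)$.
   Context: For a positive integer $n$, $[n]=\{1,\dots,n\}$. An edge-coloring of $K_n$ with $k$ colors is a map $f:\binom{[n]}{2}\to[k]$; $\alpha_i(f)$ is the independence number of the graph on $[n]$ whose edges are the pairs of color $i$. For positive integers $m_1,\dots,m_k$, $\bar{R}(m_1,\dots,m_k)$ is the least positive integer $n$ such that every edge-coloring $f$ of $K_n$ with $k$ colors has some $i\in[k]$ with $\alpha_i(f)\ge m_i$. -}

module Defs where

open import Data.Nat using (ℕ; _≤_; _<_)
open import Data.Fin as Fin using (Fin)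
open import Data.Fin.Subset using (Subset; _∈_; ∣_∣)
open import Data.Vec using (Vec; lookup)
open import Data.Empty
open import Data.Product using (∃; Σ; _×_)
open import Relation.Binary.PropositionalEquality using (_≢_)

-- An edge-coloring of K_n with k colors: a color for every unordered pair
-- {x,y} of distinct vertices, represented by x < y (proof irrelevant).
Coloring : ℕ → ℕ → Set
Coloring n k = (x y : Fin n) → .(x Fin.< y) → Fin k

IndependentIn : ∀ {n k} → Coloring n k → Fin k → Subset n → Set
IndependentIn {n} f i S =
  (x y : Fin n) → (p : x Fin.< y) → x ∈ S → y ∈ S → f x y p ≢ i

IndepNum≥ : ∀ {n k} → Coloring n k → Fin k → ℕ → Set
IndepNum≥ {n} f i m = Σ (Subset n) λ S → IndependentIn f i S × m ≤ ∣ S ∣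

Forces : ∀ {k} → Vec ℕ k → ℕ → Set
Forces {k} ms n = (f : Coloring n k) → ∃ λ (i : Fin k) → IndepNum≥ f i (lookup ms i)

IsRbar : ∀ {k} → Vec ℕ k → ℕ → Set
IsRbar ms r = 1 ≤ r × Forces ms r × ((n : ℕ) → 1 ≤ n → n < r → ¬Forces n)
  where
  ¬Forces : ℕ → Set
  ¬Forces n = Forces ms n → Data.Empty.⊥

-- Part one: a (k+1)-colouring becomes a k-colouring once the new colour is
-- merged into colour k, and merging only shrinks independent sets, so every
-- n forcing (m₁,…,m_k) also forces (m₁,…,m_k,m); the least such n then
-- exists because forcing is decidable (colourings of K_n form a finite,
-- exhaustively searchable set). Part two: a k-colouring is a (k+1)-colouring
-- avoiding the new colour, whose independent sets have at most n < m
-- vertices, so below R̄(m₁,…,m_k) ≤ m the extended vector is not forced.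
module Submission where

open import Defs
open import Data.Nat using (ℕ; zero; suc; _≤_; _<_)
open import Data.Nat.Properties using (_≤?_; ≤-refl; ≤-trans; <-≤-trans; <⇒≤; <⇒≱; m<1+n⇒m<n∨m≡n; m≤n⇒m≤1+n)
open import Data.Vec using (Vec; []; _∷_; _∷ʳ_; lookup)
open import Data.Vec.Relation.Unary.All using (All)
open import Data.Vec.Functional using (Vector; head; tail) renaming ([] to ⟨⟩; _∷_ to _◂_)
open import Data.Vec.Functional.Relation.Binary.Pointwise using (Pointwise)
open import Data.Fin as Fin using (Fin; inject₁; fromℕ; pinch)
open import Data.Fin.Properties using (all?; any?; _≟_; _<?_)
open import Data.Fin.Relation.Unary.Top using (view; ‵fromℕ; ‵inject₁)
open import Data.Fin.Subset using (_∈_; ∣_∣)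
open import Data.Fin.Subset.Properties using (_∈?_; ∣p∣≤n; anySubset?)
open import Function using (_∘_)
open import Level using (0ℓ)
open import Data.Product using (∃; _×_; _,_)
open import Data.Sum using (_⊎_; inj₁; inj₂; [_,_]′)
open import Relation.Binary using (Rel; Reflexive; _Respects_)
open import Relation.Binary.PropositionalEquality using (_≡_; _≢_; refl; cong; sym; trans; subst)
open import Relation.Nullary using (Dec; yes; no; ¬_; contradiction)
open import Relation.Nullary.Decidable using (map′; _×-dec_; _→-dec_; ¬?)
open import Relation.Unary using (Pred; Decidable)

lookup-∷ʳ-inject₁ : ∀ {k} (ms : Vec ℕ k) m (i : Fin k) → lookup (ms ∷ʳ m) (inject₁ i) ≡ lookup ms i
lookup-∷ʳ-inject₁ (_ ∷ ms) m Fin.zero    = refl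
lookup-∷ʳ-inject₁ (_ ∷ ms) m (Fin.suc i) = lookup-∷ʳ-inject₁ ms m i

lookup-∷ʳ-fromℕ : ∀ {k} (ms : Vec ℕ k) m → lookup (ms ∷ʳ m) (fromℕ k) ≡ m
lookup-∷ʳ-fromℕ []       m = refl
lookup-∷ʳ-fromℕ (_ ∷ ms) m = lookup-∷ʳ-fromℕ ms m

pinch-fromℕ-inject₁ : ∀ {k} (i : Fin (suc k)) → pinch (fromℕ k) (inject₁ i) ≡ i
pinch-fromℕ-inject₁ Fin.zero           = refl
pinch-fromℕ-inject₁ {suc k} (Fin.suc i) = cong Fin.suc (pinch-fromℕ-inject₁ i)

HasLargeIndependentSet : ∀ {n k} → Vec ℕ k → Coloring n k → Set
HasLargeIndependentSet ms f = ∃ λ i → IndepNum≥ f i (lookup ms i)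

recolour : ∀ {n k l} → (Fin k → Fin l) → Coloring n k → Coloring n l
recolour φ f x y p = φ (f x y p)

independentIn-recolour⁻ : ∀ {n k l} (φ : Fin k → Fin l) {f : Coloring n k} {i j S} →
  φ j ≡ i → IndependentIn (recolour φ f) i S → IndependentIn f j S
independentIn-recolour⁻ φ φj≡i ind x y p x∈S y∈S fxy≡j =
  ind x y p x∈S y∈S (trans (cong φ fxy≡j) φj≡i)

indepNum≥-recolour⁻ : ∀ {n k l} (φ : Fin k → Fin l) {f : Coloring n k} {i j m} →
  φ j ≡ i → IndepNum≥ (recolour φ f) i m → IndepNum≥ f j m
indepNum≥-recolour⁻ φ φj≡i (S , ind , m≤∣S∣) = S , independentIn-recolour⁻ φ φj≡i ind , m≤∣S∣

-- The new colour is merged into the last old one.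
forces-∷ʳ : ∀ {k n} (ms : Vec ℕ (suc k)) m → Forces ms n → Forces (ms ∷ʳ m) n
forces-∷ʳ {k} ms m F f with F (recolour (pinch (fromℕ k)) f)
... | i , big = inject₁ i , subst (IndepNum≥ f (inject₁ i)) (sym (lookup-∷ʳ-inject₁ ms m i))
                                  (indepNum≥-recolour⁻ (pinch (fromℕ k)) (pinch-fromℕ-inject₁ i) big)

forces-∷ʳ⁻ : ∀ {k n} (ms : Vec ℕ k) m → n < m → Forces (ms ∷ʳ m) n → Forces ms n
forces-∷ʳ⁻ ms m n<m F f with F (recolour inject₁ f)
... | i , S , ind , le with view i
...   | ‵inject₁ j =
        j , indepNum≥-recolour⁻ inject₁ refl (S , ind , subst (_≤ ∣ S ∣) (lookup-∷ʳ-inject₁ ms m j) le)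
...   | ‵fromℕ     = contradiction (≤-trans m≤∣S∣ (∣p∣≤n S)) (<⇒≱ n<m)
  where
  m≤∣S∣ : m ≤ ∣ S ∣
  m≤∣S∣ = subst (_≤ ∣ S ∣) (lookup-∷ʳ-fromℕ ms m) le

Exhaustible : (A : Set) → Rel A 0ℓ → Set₁
Exhaustible A _≈_ = ∀ {P : Pred A 0ℓ} → P Respects _≈_ → Decidable P → Dec (∀ x → P x)

Fin-exhaustible : ∀ {n} → Exhaustible (Fin n) _≡_
Fin-exhaustible _ P? = all? P?

Vector-exhaustible : ∀ {A : Set} {_≈_ : Rel A 0ℓ} → Reflexive _≈_ → Exhaustible A _≈_ →
  ∀ n → Exhaustible (Vector A n) (Pointwise _≈_)
Vector-exhaustible ≈-refl exhaustA zero resp P? =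
  map′ (λ P⟨⟩ v → resp (λ ()) P⟨⟩) (λ ∀P → ∀P ⟨⟩) (P? ⟨⟩)
Vector-exhaustible {_≈_ = _≈_} ≈-refl exhaustA (suc n) {P} resp P? =
  map′ (λ ∀P◂ v → resp head◂tail≈ (∀P◂ (head v) (tail v))) (λ ∀P x v → ∀P (x ◂ v))
       (exhaustA resp-head (λ x → Vector-exhaustible ≈-refl exhaustA n resp-tail (λ v → P? (x ◂ v))))
  where
  head◂tail≈ : ∀ {v} → Pointwise _≈_ (head v ◂ tail v) v
  head◂tail≈ Fin.zero    = ≈-refl
  head◂tail≈ (Fin.suc i) = ≈-refl

  resp-head : (λ x → ∀ v → P (x ◂ v)) Respects _≈_
  resp-head x≈y ∀P◂ v = resp (λ { Fin.zero → x≈y ; (Fin.suc i) → ≈-refl }) (∀P◂ v)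

  resp-tail : ∀ {x} → (λ v → P (x ◂ v)) Respects Pointwise _≈_
  resp-tail v≈w = resp (λ { Fin.zero → ≈-refl ; (Fin.suc i) → v≈w i })

independentIn? : ∀ {n k} (f : Coloring n k) i → Decidable (IndependentIn f i)
independentIn? f i S = all? λ x → all? λ y → edge? x y
  where
  edge? : ∀ x y → Dec ((p : x Fin.< y) → x ∈ S → y ∈ S → f x y p ≢ i)
  edge? x y with x <? y
  ... | yes p  = map′ (λ h _ → h) (λ h → h p) ((x ∈? S) →-dec (y ∈? S) →-dec ¬? (f x y p ≟ i))
  ... | no x≮y = yes λ p → contradiction p x≮y

hasLargeIndependentSet? : ∀ {n k} (ms : Vec ℕ k) → Decidable (HasLargeIndependentSet {n} ms)
hasLargeIndependentSet? ms f =
  any? λ i → anySubset? λ S → independentIn? f i S ×-dec lookup ms i ≤? ∣ S ∣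

_≐_ : ∀ {n k} → Rel (Coloring n k) 0ℓ
f ≐ g = ∀ x y p → f x y p ≡ g x y p

hasLargeIndependentSet-resp : ∀ {n k} (ms : Vec ℕ k) → HasLargeIndependentSet {n} ms Respects _≐_
hasLargeIndependentSet-resp ms f≐g (i , S , ind , le) =
  i , S , (λ x y p x∈S y∈S gxy≡i → ind x y p x∈S y∈S (trans (f≐g x y p) gxy≡i)) , le

toColoring : ∀ {n k} → Vector (Vector (Fin k) n) n → Coloring n k
toColoring g x y _ = g x y

-- Non-edges get colour zero, so at least one colour is needed.
fromColoring : ∀ {n k} → Coloring n (suc k) → Vector (Vector (Fin (suc k)) n) n
fromColoring f x y with x <? y
... | yes p = f x y p
... | no _  = Fin.zero

toColoring-fromColoring : ∀ {n k} (f : Coloring n (suc k)) → toColoring (fromColoring f) ≐ f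
toColoring-fromColoring f x y p with x <? y
... | yes _  = refl
... | no x≮y = contradiction p x≮y

forces? : ∀ {k} (ms : Vec ℕ (suc k)) n → Dec (Forces ms n)
forces? ms n =
  map′ (λ ∀g f → hasLargeIndependentSet-resp ms (toColoring-fromColoring f) (∀g (fromColoring f)))
       (λ F g → F (toColoring g))
       (Vector-exhaustible (λ _ → refl) (Vector-exhaustible refl Fin-exhaustible n) n
                           (λ g≈h → hasLargeIndependentSet-resp ms λ x y _ → g≈h x y)
                           (hasLargeIndependentSet? ms ∘ toColoring))

IsLeast : Pred ℕ 0ℓ → ℕ → Set
IsLeast P n = P n × (∀ {j} → j < n → ¬ P j)

module _ {P : Pred ℕ 0ℓ} (P? : Decidable P) where

  least-below : ∀ n → (∀ {j} → j < n → ¬ P j) ⊎ (∃ λ m → m < n × IsLeast P m)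
  least-below zero = inj₁ λ ()
  least-below (suc n) with least-below n
  ... | inj₂ (m , m<n , least) = inj₂ (m , m≤n⇒m≤1+n m<n , least)
  ... | inj₁ none with P? n
  ...   | yes Pn = inj₂ (n , ≤-refl , Pn , none)
  ...   | no ¬Pn = inj₁ λ j<1+n → [ none , (λ { refl → ¬Pn }) ]′ (m<1+n⇒m<n∨m≡n j<1+n)

  least-exists : ∀ {n} → P n → ∃ λ m → m ≤ n × IsLeast P m
  least-exists {n} Pn with least-below n
  ... | inj₁ none              = n , ≤-refl , Pn , none
  ... | inj₂ (m , m<n , least) = m , <⇒≤ m<n , least

rbar-exists : ∀ {k} (ms : Vec ℕ (suc k)) {n} → 1 ≤ n → Forces ms n → ∃ λ r → IsRbar ms r × r ≤ n
rbar-exists ms 1≤n Fn with least-exists (λ j → 1 ≤? j ×-dec forces? ms j) (1≤n , Fn)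
... | r , r≤n , (1≤r , Fr) , below =
  r , (1≤r , Fr , λ j 1≤j j<r Fj → below j<r (1≤j , Fj)) , r≤n

isRbar-∷ʳ : ∀ {k r} (ms : Vec ℕ (suc k)) m → IsRbar ms r → r ≤ m → IsRbar (ms ∷ʳ m) r
isRbar-∷ʳ ms m (1≤r , Fr , below) r≤m =
  1≤r , forces-∷ʳ ms m Fr , λ n 1≤n n<r Fn → below n 1≤n n<r (forces-∷ʳ⁻ ms m (<-≤-trans n<r r≤m) Fn)

lemma2p3 : (k : ℕ) → 1 ≤ k → (ms : Vec ℕ k) → All (1 ≤_) ms → (m : ℕ) → 1 ≤ m →
    (r : ℕ) → IsRbar ms r →
      (∃ λ r′ → IsRbar (ms ∷ʳ m) r′ × r′ ≤ r) × (r ≤ m → IsRbar (ms ∷ʳ m) r)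
lemma2p3 (suc k) _ ms _ m _ r rbar@(1≤r , Fr , _) =
  rbar-exists (ms ∷ʳ m) 1≤r (forces-∷ʳ ms m Fr) , isRbar-∷ʳ ms m rbar
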